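{- The basis of the class $Sort_2$ of $2$-sortable permutations is infinite; in particular it contains all the permutations $\alpha^{(j)}$, $j\ge0$, where $\alpha^{(j)}=2j+4,\,3,\,\omega^{(j)},\,1,\,5,\,2$ and $\omega^{(j)}$ is the concatenation of the pairs $(2i,2i+3)$ for $i=j+1,j,\dots,2$ (e.g. $\alpha^{(0)}=43152$, $\alpha^{(1)}=6347152$).
   Context: The $\mathfrak{D}^2\mathfrak{I}$ machine consists of two stacks $D_1,D_2$ in series whose elements must be in decreasing order from top to bottom (top is largest), followed by a stack $I$ whose elements must be in increasing order from top to bottom (top is smallest). The input permutation is read left to right. Operations: $d_0$: push the next input element into $D_1$; $d_1$: pop from $D_1$ into $D_2$; $d_2$: pop from $D_2$ into $I$; $d_3$: pop from $I$ and append to the output. An operation is legal if it respects the stack order restrictions ($d_3$ is considered legal if it outputs the smallest element not yet output or if no other operation is legal). A permutation $\pi$ of length $n$ is $2$-sortable if some sequence of legal operations produces output $12\cdots n$; $Sort_2$ is the set of $2$-sortable permutations, a class (downset) in the pattern-containment order. The basis of a class is the set of minimal (under pattern containment) permutations not in the class. -}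

module Defs where

open import Data.Nat using (ℕ; zero; suc; _+_; _*_; _<_; _≤_)
open import Data.List using (List; []; _∷_; _++_; [_]; length; map; upTo; foldr)
open import Data.List.Relation.Binary.Permutation.Propositional using (_↭_)
open import Data.List.Relation.Binary.Sublist.Propositional using (_⊆_)
open import Data.List.Membership.Propositional using (_∈_)
open import Data.Product using (Σ; ∃; _×_; _,_)
open import Data.Sum using (_⊎_)
open import Data.Empty using (⊥)
open import Data.Unit using (⊤)
open import Relation.Nullary using (¬_)
open import Relation.Binary.PropositionalEquality using (_≡_; _≢_)
open import Function.Bundles using (_⇔_)

identity : ℕ → List ℕ
identity n = map suc (upTo n)

IsPerm : List ℕ → Set
IsPerm π = π ↭ identity (length π)

-- safe lookup (default 0; only used with in-range indices)
nth : List ℕ → ℕ → ℕ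
nth []       _       = 0
nth (x ∷ xs) zero    = x
nth (x ∷ xs) (suc i) = nth xs i

OrderIso : List ℕ → List ℕ → Set
OrderIso σ τ = (length σ ≡ length τ) ×
  (∀ i j → i < length σ → j < length σ →
     (nth σ i < nth σ j) ⇔ (nth τ i < nth τ j))

_≼_ : List ℕ → List ℕ → Set
σ ≼ π = Σ (List ℕ) λ τ → (τ ⊆ π) × OrderIso σ τ

-- top of each stack is the head of the list
record State : Set where
  constructor st
  field
    input  : List ℕ
    D1     : List ℕ
    D2     : List ℕ
    I      : List ℕ
    output : List ℕ
open State public

-- D-stacks: top is largest, so x may be pushed iff x > top (or empty)
CanPushD : ℕ → List ℕ → Set
CanPushD x []      = ⊤
CanPushD x (y ∷ _) = y < x

-- I-stack: top is smallest, so x may be pushed iff x < top (or empty)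
CanPushI : ℕ → List ℕ → Set
CanPushI x []      = ⊤
CanPushI x (y ∷ _) = x < y

Legal0 Legal1 Legal2 : State → Set
Legal0 (st []      d1 d2 i o) = ⊥
Legal0 (st (x ∷ _) d1 d2 i o) = CanPushD x d1
Legal1 (st inp []       d2 i o) = ⊥
Legal1 (st inp (x ∷ _)  d2 i o) = CanPushD x d2
Legal2 (st inp d1 []      i o) = ⊥
Legal2 (st inp d1 (x ∷ _) i o) = CanPushI x i

IsMin : ℕ → List ℕ → Set
IsMin m xs = (m ∈ xs) × (∀ y → y ∈ xs → m ≤ y)

remaining : State → List ℕ
remaining (st inp d1 d2 i o) = inp ++ d1 ++ d2 ++ i

data Step : State → State → Set where
  d0 : ∀ {x inp d1 d2 i o} → CanPushD x d1 →
       Step (st (x ∷ inp) d1 d2 i o) (st inp (x ∷ d1) d2 i o)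
  d1 : ∀ {x inp d1 d2 i o} → CanPushD x d2 →
       Step (st inp (x ∷ d1) d2 i o) (st inp d1 (x ∷ d2) i o)
  d2 : ∀ {x inp d1 d2 i o} → CanPushI x i →
       Step (st inp d1 (x ∷ d2) i o) (st inp d1 d2 (x ∷ i) o)
  d3 : ∀ {x inp d1 d2 i o} →
       (IsMin x (remaining (st inp d1 d2 (x ∷ i) o))
         ⊎ (¬ Legal0 (st inp d1 d2 (x ∷ i) o)
            × ¬ Legal1 (st inp d1 d2 (x ∷ i) o)
            × ¬ Legal2 (st inp d1 d2 (x ∷ i) o))) →
       Step (st inp d1 d2 (x ∷ i) o) (st inp d1 d2 i (o ++ [ x ]))

data Steps : State → State → Set where
  done : ∀ {s} → Steps s s
  _▸_  : ∀ {s t u} → Step s t → Steps t u → Steps s u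

Sortable2 : List ℕ → Set
Sortable2 π = Σ State λ s →
  Steps (st π [] [] [] []) s × (output s ≡ identity (length π))

InBasis : List ℕ → Set
InBasis π = IsPerm π × ¬ Sortable2 π ×
  (∀ σ → IsPerm σ → σ ≼ π → σ ≢ π → Sortable2 σ)

-- ω m = pairs (2i, 2i+3) for i = m+1, m, ..., 2
ω : ℕ → List ℕ
ω zero    = []
ω (suc m) = 2 * (m + 2) ∷ 2 * (m + 2) + 3 ∷ ω m

α : ℕ → List ℕ
α j = (2 * j + 4) ∷ 3 ∷ ω j ++ (1 ∷ 5 ∷ 2 ∷ [])

module Submission where

-- A run that sorts a permutation must output k+1 right after
--    1 … k, i.e. always the smallest remaining value, so 2-sortability of a
--    permutation is equivalent to completion by normal steps _↝_, whose output
--    step emits the minimum (sortable⇒completes, completes⇒sortable).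
-- 2. Pattern closure.  A normal run on π is mimicked on any pattern σ of π by
--    copying the steps on the entries of the occurrence (pattern-closed).  Until 3 passes from D1 to D2 nothing can be output
--    and 1 cannot be read; when it passes, some z > 3 lies in I below a later
--    y > z, which blocks y and then 2 forever (α-not-completes).
-- 4. Every one-point deletion of α j is sorted by an explicit normal run that
--    processes ω pair by pair (α-deletion-completes).

open import Defs
open import Data.Nat using (ℕ; zero; suc; _+_; _*_; _∸_; _<_; _≤_; z≤n; s≤s; _<?_; _≟_)
open import Data.Nat.Properties
open import Relation.Binary.Definitions using (tri<; tri≈; tri>)
open import Data.Nat.Tactic.RingSolver using (solve-∀)
open import Data.List using (List; []; _∷_; _++_; [_]; length; map; applyUpTo; zip; filter)
open import Data.Nat.ListAction using (sum)
open import Data.List.Properties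
  using (++-cancelˡ; ++-conicalˡ; ++-conicalʳ; ++-assoc; ++-identityʳ; ∷-injective; filter-++; filter-all; length-++; filter-none; filter-accept; filter-reject)
open import Data.List.Relation.Unary.All using (All; []; _∷_)
import Data.List.Relation.Unary.All as All
open import Data.List.Relation.Unary.AllPairs using (AllPairs; []; _∷_)
open import Data.List.Relation.Unary.Any using (here; there)
open import Data.List.Membership.Propositional using (_∈_; _∉_)
open import Data.List.Membership.Propositional.Properties using (∈-++⁺ˡ; ∈-++⁺ʳ; ∈-++⁻)
open import Data.List.Relation.Binary.Permutation.Propositional
  using (_↭_; ↭-sym; ↭-trans; prep; swap; module PermutationReasoning) renaming (refl to ↭-refl)
open import Data.List.Relation.Binary.Permutation.Propositional.Properties
  using (shift; ++⁺ˡ; ++⁺ʳ; ++-comm; drop-∷; ∈-resp-↭; ↭-length; ↭-empty-inv; ∷↭∷ʳ; filter-↭)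
open import Data.List.Relation.Binary.Sublist.Heterogeneous
  using (Sublist; []; _∷_; _∷ʳ_)
import Data.List.Relation.Binary.Sublist.Heterogeneous as Sublist
open import Data.List.Relation.Binary.Sublist.Propositional using (_⊆_)
open import Data.List.Relation.Binary.Sublist.Heterogeneous.Properties
  using (++⁺; length-mono-≤; toPointwise) renaming (trans to sublist-trans)
open import Data.List.Relation.Binary.Pointwise using (Pointwise-≡⇒≡)
open import Data.Product using (Σ; ∃; _×_; _,_; proj₁; proj₂)
open import Data.Sum using (_⊎_; inj₁; inj₂)
open import Data.Empty using (⊥; ⊥-elim)
open import Data.Unit using (tt)
open import Relation.Nullary using (¬_; yes; no)
open import Relation.Nullary.Decidable using (True; toWitness)
open import Relation.Binary.PropositionalEquality hiding ([_])
open import Function using (_∘_; id)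
open import Function.Bundles using (Equivalence)
open import Relation.Binary.Construct.Closure.ReflexiveTransitive using (Star; ε; _◅_; _◅◅_)

Decreasing Increasing : List ℕ → Set
Decreasing = AllPairs (λ x y → y < x)
Increasing = AllPairs _<_

push-decreasing : ∀ {x d} → CanPushD x d → Decreasing d → Decreasing (x ∷ d)
push-decreasing {d = []}    _   _           = [] ∷ []
push-decreasing {d = _ ∷ _} y<x ds@(ys ∷ _) = (y<x ∷ All.map (λ z<y → <-trans z<y y<x) ys) ∷ ds

push-increasing : ∀ {x d} → CanPushI x d → Increasing d → Increasing (x ∷ d)
push-increasing {d = []}    _   _           = [] ∷ []
push-increasing {d = _ ∷ _} x<y is@(ys ∷ _) = (x<y ∷ All.map (<-trans x<y) ys) ∷ is

below-pushable : ∀ {x b d} → Decreasing d → b ∈ d → CanPushD x d → b < x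
below-pushable _           (here refl) y<x = y<x
below-pushable (ys ∷ _)    (there b∈)  y<x = <-trans (All.lookup ys b∈) y<x

above-pushable : ∀ {x b d} → Increasing d → b ∈ d → CanPushI x d → x < b
above-pushable _           (here refl) x<y = x<y
above-pushable (ys ∷ _)    (there b∈)  x<y = <-trans x<y (All.lookup ys b∈)

-- A normal step is a legal step whose output operation emits the smallest
-- element not yet output (the first alternative of d3).  Every run that
-- sorts a permutation is normal, so it suffices to study normal runs.

infix 4 _↝_ _↝*_

data _↝_ : State → State → Set where
  read  : ∀ {x inp u v i o} → CanPushD x u →
          st (x ∷ inp) u v i o ↝ st inp (x ∷ u) v i o
  pass  : ∀ {x inp u v i o} → CanPushD x v →
          st inp (x ∷ u) v i o ↝ st inp u (x ∷ v) i o
  sink  : ∀ {x inp u v i o} → CanPushI x i →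
          st inp u (x ∷ v) i o ↝ st inp u v (x ∷ i) o
  emit  : ∀ {x inp u v i o} → IsMin x (inp ++ u ++ v ++ x ∷ i) →
          st inp u v (x ∷ i) o ↝ st inp u v i (o ++ [ x ])

_↝*_ : State → State → Set
_↝*_ = Star _↝_

start : List ℕ → State
start π = st π [] [] [] []

final : List ℕ → State
final o = st [] [] [] [] o

Completes : State → Set
Completes s = ∃ λ o → s ↝* final o

after : ∀ {s t} → s ↝* t → Completes t → Completes s
after run (o , rest) = o , (run ◅◅ rest)

normal⇒legal : ∀ {s t} → s ↝* t → Steps s t
normal⇒legal ε               = done
normal⇒legal (read p  ◅ run) = d0 p ▸ normal⇒legal run
normal⇒legal (pass p  ◅ run) = d1 p ▸ normal⇒legal run
normal⇒legal (sink p  ◅ run) = d2 p ▸ normal⇒legal run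
normal⇒legal (emit p  ◅ run) = d3 (inj₁ p) ▸ normal⇒legal run

WellStacked : State → Set
WellStacked s = Decreasing (D1 s) × Decreasing (D2 s) × Increasing (I s)

wellStacked-step : ∀ {s t} → s ↝ t → WellStacked s → WellStacked t
wellStacked-step (read p) (u , v , i)       = push-decreasing p u , v , i
wellStacked-step (pass p) (_ ∷ u , v , i)   = u , push-decreasing p v , i
wellStacked-step (sink p) (u , _ ∷ v , i)   = u , v , push-increasing p i
wellStacked-step (emit _) (u , v , _ ∷ i)   = u , v , i

interval : ℕ → ℕ → List ℕ
interval lo zero    = []
interval lo (suc k) = lo ∷ interval (suc lo) k

interval-length : ∀ lo k → length (interval lo k) ≡ k
interval-length lo zero    = refl
interval-length lo (suc k) = cong suc (interval-length (suc lo) k)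

interval-lower : ∀ {y} lo k → y ∈ interval lo k → lo ≤ y
interval-lower lo (suc k) (here refl) = ≤-refl
interval-lower lo (suc k) (there p)   = <⇒≤ (interval-lower (suc lo) k p)

interval-first : ∀ {y lo k} → y ∈ interval lo k → lo ∈ interval lo k
interval-first {k = suc k} _ = here refl

interval-upper : ∀ {y} lo k → y ∈ interval lo k → y < lo + k
interval-upper lo (suc k) (here refl) = subst (lo <_) (sym (+-suc lo k)) (s≤s (m≤m+n lo k))
interval-upper {y} lo (suc k) (there p)   = subst (y <_) (sym (+-suc lo k)) (interval-upper (suc lo) k p)

interval-++ : ∀ lo a b → interval lo (a + b) ≡ interval lo a ++ interval (lo + a) b
interval-++ lo zero    b = cong (λ l → interval l b) (sym (+-identityʳ lo))
interval-++ lo (suc a) b = cong (lo ∷_) (begin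
  interval (suc lo) (a + b)                  ≡⟨ interval-++ (suc lo) a b ⟩
  interval (suc lo) a ++ interval (suc lo + a) b ≡⟨ cong (λ l → interval (suc lo) a ++ interval l b) (sym (+-suc lo a)) ⟩
  interval (suc lo) a ++ interval (lo + suc a) b ∎)
  where open ≡-Reasoning

interval-snoc : ∀ k → interval 1 k ++ [ suc k ] ≡ interval 1 (suc k)
interval-snoc k = trans (sym (interval-++ 1 k 1)) (cong (interval 1) (+-comm k 1))

identity-interval : ∀ n → identity n ≡ interval 1 n
identity-interval n = go id 0 n (λ _ → refl)
  where
  go : ∀ (f : ℕ → ℕ) lo n → (∀ i → f i ≡ lo + i) → map suc (applyUpTo f n) ≡ interval (suc lo) n
  go f lo zero    _  = refl
  go f lo (suc n) f≗ = cong₂ _∷_ (cong suc (trans (f≗ 0) (+-identityʳ lo)))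
                         (go (f ∘ suc) (suc lo) n (λ i → trans (f≗ (suc i)) (+-suc lo i)))

read-↭ : ∀ (x : ℕ) inp u v i → (x ∷ inp) ++ u ++ v ++ i ↭ inp ++ (x ∷ u) ++ v ++ i
read-↭ x inp u v i = ↭-sym (shift x inp (u ++ v ++ i))

pass-↭ : ∀ (x : ℕ) inp u v i → inp ++ (x ∷ u) ++ v ++ i ↭ inp ++ u ++ (x ∷ v) ++ i
pass-↭ x inp u v i = ++⁺ˡ inp (↭-sym (shift x u (v ++ i)))

sink-↭ : ∀ (x : ℕ) inp u v i → inp ++ u ++ (x ∷ v) ++ i ↭ inp ++ u ++ v ++ x ∷ i
sink-↭ x inp u v i = ++⁺ˡ inp (++⁺ˡ u (↭-sym (shift x v i)))

emit-↭ : ∀ (x : ℕ) inp u v i → inp ++ u ++ v ++ x ∷ i ↭ x ∷ inp ++ u ++ v ++ i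
emit-↭ x inp u v i = ↭-sym (↭-trans (read-↭ x inp u v i) (↭-trans (pass-↭ x inp u v i) (sink-↭ x inp u v i)))

top-of-I∈ : ∀ (x : ℕ) inp u v i → x ∈ inp ++ u ++ v ++ x ∷ i
top-of-I∈ x inp u v i = ∈-++⁺ʳ inp (∈-++⁺ʳ u (∈-++⁺ʳ v (here refl)))

record Progress (n : ℕ) (s : State) : Set where
  constructor progress
  field
    emitted   : ℕ
    left      : ℕ
    output≡   : output s ≡ interval 1 emitted
    remaining↭ : remaining s ↭ interval (suc emitted) left
    total     : emitted + left ≡ n
open Progress

initial-progress : ∀ {π} → IsPerm π → Progress (length π) (start π)
initial-progress {π} perm = progress 0 (length π) refl rem refl
  where
  rem : π ++ [] ↭ interval 1 (length π)
  rem = subst₂ _↭_ (sym (++-identityʳ π)) (identity-interval (length π)) perm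

emit-next : ∀ {n x inp u v i o} (pr : Progress n (st inp u v (x ∷ i) o)) → x ≡ suc (emitted pr) →
            IsMin x (inp ++ u ++ v ++ x ∷ i) × Progress n (st inp u v i (o ++ [ x ]))
emit-next {x = x} {inp} {u} {v} {i} (progress k zero _ rem _) refl
  with () ← ∈-resp-↭ rem (top-of-I∈ x inp u v i)
emit-next {x = x} {inp} {u} {v} {i} (progress k (suc m) out rem tot) refl =
  (top-of-I∈ x inp u v i , λ y y∈ → interval-lower (suc k) (suc m) (∈-resp-↭ rem y∈)) ,
  progress (suc k) m (trans (cong (_++ [ x ]) out) (interval-snoc k))
    (drop-∷ (↭-trans (↭-sym (emit-↭ x inp u v i)) rem)) (trans (sym (+-suc k m)) tot)

progress-step : ∀ {n s t} → s ↝ t → Progress n s → Progress n t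
progress-step (read {x} {inp} {u} {v} {i} _) (progress k m out rem tot) =
  progress k m out (↭-trans (↭-sym (read-↭ x inp u v i)) rem) tot
progress-step (pass {x} {inp} {u} {v} {i} _) (progress k m out rem tot) =
  progress k m out (↭-trans (↭-sym (pass-↭ x inp u v i)) rem) tot
progress-step (sink {x} {inp} {u} {v} {i} _) (progress k m out rem tot) =
  progress k m out (↭-trans (↭-sym (sink-↭ x inp u v i)) rem) tot
progress-step (emit (x∈ , x-min)) pr@(progress k m _ rem _) =
  proj₂ (emit-next pr (≤-antisym (x-min (suc k) (∈-resp-↭ (↭-sym rem) (interval-first x∈′)))
                                 (interval-lower (suc k) m x∈′)))
  where x∈′ = ∈-resp-↭ rem x∈

completed-output : ∀ {n s o} → s ↝* final o → Progress n s → o ≡ interval 1 n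
completed-output ε (progress k m out rem tot) = trans out (cong (interval 1) k≡n)
  where
  k≡n : k ≡ _
  k≡n = trans (sym (+-identityʳ k))
          (trans (cong (k +_) (trans (↭-length rem) (interval-length _ m))) tot)
completed-output (step ◅ run) pr = completed-output run (progress-step step pr)

output-grows : ∀ {s t} → Steps s t → ∃ λ r → output t ≡ output s ++ r
output-grows done = [] , sym (++-identityʳ _)
output-grows (d0 _ ▸ run) = output-grows run
output-grows (d1 _ ▸ run) = output-grows run
output-grows (d2 _ ▸ run) = output-grows run
output-grows (d3 {x} {o = o} _ ▸ run) with r , eq ← output-grows run =
  x ∷ r , trans eq (++-assoc o [ x ] r)

next-output : ∀ {n s x r} (pr : Progress n s) → (output s ++ [ x ]) ++ r ≡ interval 1 n →
              x ≡ suc (emitted pr)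
next-output {n} {s} {x} {r} (progress k m out _ tot) sorted =
  head-of m (++-cancelˡ (interval 1 k) (x ∷ r) (interval (suc k) m) (begin
    interval 1 k ++ x ∷ r              ≡⟨ cong (_++ x ∷ r) out ⟨
    output s ++ [ x ] ++ r             ≡⟨ ++-assoc (output s) [ x ] r ⟨
    (output s ++ [ x ]) ++ r           ≡⟨ sorted ⟩
    interval 1 n                       ≡⟨ cong (interval 1) tot ⟨
    interval 1 (k + m)                 ≡⟨ interval-++ 1 k m ⟩
    interval 1 k ++ interval (suc k) m ∎))
  where
  open ≡-Reasoning
  head-of : ∀ m → x ∷ r ≡ interval (suc k) m → x ≡ suc k
  head-of zero    ()
  head-of (suc _) refl = refl

nothing-remains : ∀ {n s} → Progress n s → output s ≡ interval 1 n → remaining s ≡ []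
nothing-remains {n} {s} (progress k m out rem tot) done-out =
  ↭-empty-inv (subst (λ l → remaining s ↭ interval (suc k) l) m≡0 rem)
  where
  k≡n : k ≡ n
  k≡n = trans (sym (interval-length 1 k)) (trans (cong length (trans (sym out) done-out)) (interval-length 1 n))
  m≡0 : m ≡ 0
  m≡0 = +-cancelˡ-≡ k m 0 (trans tot (trans (sym k≡n) (sym (+-identityʳ k))))

empty-final : ∀ {inp u v i o} → inp ++ u ++ v ++ i ≡ [] → st inp u v i o ≡ final o
empty-final {inp} {u} {v} e
  with refl ← ++-conicalˡ inp _ e
  with refl ← ++-conicalˡ u _ e
  with refl ← ++-conicalˡ v _ e
  with refl ← e = refl

-- A legal run that sorts makes only normal steps: each d3 must output the
-- next value k+1, which is the smallest remaining element.
normalise : ∀ {n s t} → Steps s t → Progress n s → output t ≡ interval 1 n → Completes s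
normalise {s = s} done pr sorted = output s , subst (s ↝*_) (empty-final (nothing-remains pr sorted)) ε
normalise (d0 p ▸ run) pr sorted = after (read p ◅ ε) (normalise run (progress-step (read p) pr) sorted)
normalise (d1 p ▸ run) pr sorted = after (pass p ◅ ε) (normalise run (progress-step (pass p) pr) sorted)
normalise (d2 p ▸ run) pr sorted = after (sink p ◅ ε) (normalise run (progress-step (sink p) pr) sorted)
normalise (d3 _ ▸ run) pr sorted
  with r , grows ← output-grows run
  with x-min , pr′ ← emit-next pr (next-output pr (trans (sym grows) sorted))
  = after (emit x-min ◅ ε) (normalise run pr′ sorted)

sortable⇒completes : ∀ {π} → IsPerm π → Sortable2 π → Completes (start π)
sortable⇒completes perm (_ , run , sorted) =
  normalise run (initial-progress perm) (trans sorted (identity-interval _))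

completes⇒sortable : ∀ {π} → IsPerm π → Completes (start π) → Sortable2 π
completes⇒sortable perm (o , run) =
  final o , normal⇒legal run ,
  trans (completed-output run (initial-progress perm)) (sym (identity-interval _))

-- A run on π can then be mimicked on any σ embedded in π via R: each
-- step on an element related to one of σ is copied, other steps are skipped.

Coherent : (ℕ → ℕ → Set) → Set
Coherent R = ∀ {a b c d} → R a b → R c d → (a < c → b < d) × (b < d → a < c)

Embedded : (ℕ → ℕ → Set) → State → State → Set
Embedded R s′ s = Sublist R (input s′) (input s) × Sublist R (D1 s′) (D1 s)
                × Sublist R (D2 s′) (D2 s) × Sublist R (I s′) (I s)

related-element : ∀ {R : ℕ → ℕ → Set} {xs ys a} → Sublist R xs ys → a ∈ xs → Σ ℕ λ b → b ∈ ys × R a b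
related-element (y ∷ʳ sub) a∈          with b , b∈ , r ← related-element sub a∈ = b , there b∈ , r
related-element (r ∷ sub)  (here refl) = _ , here refl , r
related-element (_ ∷ sub)  (there a∈)  with b , b∈ , r ← related-element sub a∈ = b , there b∈ , r

module Simulation {R : ℕ → ℕ → Set} (coherent : Coherent R) where

  pushableD : ∀ {a x d d′} → R a x → Sublist R d′ d → Decreasing d → CanPushD x d → CanPushD a d′
  pushableD {d′ = []}    _ _   _  _ = tt
  pushableD {d′ = _ ∷ _} r sub ds p with b , b∈ , rb ← related-element sub (here refl) =
    proj₂ (coherent rb r) (below-pushable ds b∈ p)

  pushableI : ∀ {a x d d′} → R a x → Sublist R d′ d → Increasing d → CanPushI x d → CanPushI a d′
  pushableI {d′ = []}    _ _   _  _ = tt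
  pushableI {d′ = _ ∷ _} r sub is p with b , b∈ , rb ← related-element sub (here refl) =
    proj₂ (coherent r rb) (above-pushable is b∈ p)

  minimal : ∀ {a x xs ys} → R a x → Sublist R xs ys → IsMin x ys → a ∈ xs → IsMin a xs
  minimal r sub (_ , x-min) a∈ = a∈ , λ y y∈ →
    let z , z∈ , rz = related-element sub y∈
    in ≮⇒≥ (λ y<a → <⇒≱ (proj₁ (coherent rz r) y<a) (x-min z z∈))

  simulate-step : ∀ {s t s′} → s ↝ t → WellStacked s → Embedded R s′ s →
                  ∃ λ t′ → s′ ↝* t′ × Embedded R t′ t
  simulate-step (read p) (u , _) (r ∷ inp , sub₁ , sub₂ , subI) =
    _ , read (pushableD r sub₁ u p) ◅ ε , inp , r ∷ sub₁ , sub₂ , subI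
  simulate-step (read p) _ (_ ∷ʳ inp , sub₁ , sub₂ , subI) =
    _ , ε , inp , _ ∷ʳ sub₁ , sub₂ , subI
  simulate-step (pass p) (_ , v , _) (inp , r ∷ sub₁ , sub₂ , subI) =
    _ , pass (pushableD r sub₂ v p) ◅ ε , inp , sub₁ , r ∷ sub₂ , subI
  simulate-step (pass p) _ (inp , _ ∷ʳ sub₁ , sub₂ , subI) =
    _ , ε , inp , sub₁ , _ ∷ʳ sub₂ , subI
  simulate-step (sink p) (_ , _ , i) (inp , sub₁ , r ∷ sub₂ , subI) =
    _ , sink (pushableI r subI i p) ◅ ε , inp , sub₁ , sub₂ , r ∷ subI
  simulate-step (sink p) _ (inp , sub₁ , _ ∷ʳ sub₂ , subI) =
    _ , ε , inp , sub₁ , sub₂ , _ ∷ʳ subI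
  simulate-step {s′ = st inp′ u′ v′ (a ∷ i′) _} (emit x-min) _ (inp , sub₁ , sub₂ , r ∷ subI) =
    _ , emit (minimal r (++⁺ inp (++⁺ sub₁ (++⁺ sub₂ (r ∷ subI)))) x-min (top-of-I∈ a inp′ u′ v′ i′)) ◅ ε ,
    inp , sub₁ , sub₂ , subI
  simulate-step (emit _) _ (inp , sub₁ , sub₂ , _ ∷ʳ subI) =
    _ , ε , inp , sub₁ , sub₂ , subI

  simulate : ∀ {s t s′} → s ↝* t → WellStacked s → Embedded R s′ s →
             ∃ λ t′ → s′ ↝* t′ × Embedded R t′ t
  simulate ε _ emb = _ , ε , emb
  simulate (step ◅ run) ws emb
    with t′ , run′ , emb′ ← simulate-step step ws emb
    with u′ , run″ , emb″ ← simulate run (wellStacked-step step ws) emb′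
    = u′ , run′ ◅◅ run″ , emb″

  -- Everything embeds in the final state only if it is itself final.
  completes-embedded : ∀ {σ π} → Sublist R σ π → Completes (start π) → Completes (start σ)
  completes-embedded emb (_ , run)
    with st [] [] [] [] o , run′ , ([] , [] , [] , []) ← simulate run ([] , [] , []) (emb , [] , [] , [])
    = o , run′

Aligned : List ℕ → List ℕ → ℕ → ℕ → Set
Aligned σ τ a b = (a , b) ∈ zip σ τ

aligned-positions : ∀ σ τ {a b} → Aligned σ τ a b →
                    Σ ℕ λ i → i < length σ × nth σ i ≡ a × nth τ i ≡ b
aligned-positions (_ ∷ σ) (_ ∷ τ) (here refl) = 0 , s≤s z≤n , refl , refl
aligned-positions (_ ∷ σ) (_ ∷ τ) (there p)
  with i , i< , eσ , eτ ← aligned-positions σ τ p = suc i , s≤s i< , eσ , eτ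

aligned-coherent : ∀ σ τ → OrderIso σ τ → Coherent (Aligned σ τ)
aligned-coherent σ τ (_ , iso) rab rcd
  with i , i< , refl , refl ← aligned-positions σ τ rab
  with k , k< , refl , refl ← aligned-positions σ τ rcd
  = Equivalence.to (iso i k i< k<) , Equivalence.from (iso i k i< k<)

aligned : ∀ σ τ → length σ ≡ length τ → Sublist (Aligned σ τ) σ τ
aligned []      []      _  = []
aligned (_ ∷ σ) (_ ∷ τ) eq = here refl ∷ Sublist.map there (aligned σ τ (suc-injective eq))

pattern-closed : ∀ {σ π} → σ ≼ π → Completes (start π) → Completes (start σ)
pattern-closed {σ} (τ , τ⊆π , iso) =
  Simulation.completes-embedded (aligned-coherent σ τ iso)
    (sublist-trans (λ r b≡c → subst (Aligned σ τ _) b≡c r) (aligned σ τ (proj₁ iso)) τ⊆π)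

-- In a permutation, each entry v is determined by its rank (number of
-- smaller entries) as v = rank + 1; ranks are preserved by order
-- isomorphisms, so order-isomorphic permutations coincide.

rank : ℕ → List ℕ → ℕ
rank v xs = length (filter (_<? v) xs)

rank-↭ : ∀ {v xs ys} → xs ↭ ys → rank v xs ≡ rank v ys
rank-↭ {v} xs↭ys = ↭-length (filter-↭ (_<? v) xs↭ys)

rank-interval : ∀ w r → rank (suc w) (interval 1 (w + r)) ≡ w
rank-interval w r = begin
  length (filter (_<? suc w) (interval 1 (w + r)))
    ≡⟨ cong (length ∘ filter (_<? suc w)) (interval-++ 1 w r) ⟩
  length (filter (_<? suc w) (interval 1 w ++ interval (suc w) r))
    ≡⟨ cong length (filter-++ (_<? suc w) (interval 1 w) (interval (suc w) r)) ⟩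
  length (filter (_<? suc w) (interval 1 w) ++ filter (_<? suc w) (interval (suc w) r))
    ≡⟨ cong₂ (λ l l′ → length (l ++ l′)) (filter-all (_<? suc w) (All.tabulate (interval-upper 1 w)))
                                          (filter-none (_<? suc w) (All.tabulate λ y∈ → ≤⇒≯ (interval-lower (suc w) r y∈))) ⟩
  length (interval 1 w ++ [])
    ≡⟨ cong length (++-identityʳ (interval 1 w)) ⟩
  length (interval 1 w)
    ≡⟨ interval-length 1 w ⟩
  w ∎
  where open ≡-Reasoning

rank-in-interval : ∀ {v n} → 1 ≤ v → v < 1 + n → suc (rank v (interval 1 n)) ≡ v
rank-in-interval {suc w} {n} _ (s≤s w<n) =
  cong suc (subst (λ m → rank (suc w) (interval 1 m) ≡ w) (m+[n∸m]≡n (<⇒≤ w<n)) (rank-interval w (n ∸ w)))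

rank-perm : ∀ {σ v} → IsPerm σ → v ∈ σ → suc (rank v σ) ≡ v
rank-perm {σ} perm v∈ =
  trans (cong suc (rank-↭ σ↭)) (rank-in-interval (interval-lower 1 n v∈′) (interval-upper 1 n v∈′))
  where
  n = length σ
  σ↭ : σ ↭ interval 1 n
  σ↭ = subst (σ ↭_) (identity-interval n) perm
  v∈′ = ∈-resp-↭ σ↭ v∈

rank-aligned : ∀ σ τ {a b} → length σ ≡ length τ →
  (∀ k → k < length σ → (nth σ k < a → nth τ k < b) × (nth τ k < b → nth σ k < a)) →
  rank a σ ≡ rank b τ
rank-aligned []      []      _  _   = refl
rank-aligned (x ∷ σ) (y ∷ τ) {a} {b} eq cmp with x <? a | y <? b
... | yes x<a | yes y<b = begin
  rank a (x ∷ σ)   ≡⟨ cong length (filter-accept (_<? a) x<a) ⟩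
  suc (rank a σ)   ≡⟨ cong suc (rank-aligned σ τ (suc-injective eq) (λ k k< → cmp (suc k) (s≤s k<))) ⟩
  suc (rank b τ)   ≡⟨ cong length (filter-accept (_<? b) y<b) ⟨
  rank b (y ∷ τ)   ∎
  where open ≡-Reasoning
... | no x≮a  | no y≮b  = begin
  rank a (x ∷ σ)   ≡⟨ cong length (filter-reject (_<? a) x≮a) ⟩
  rank a σ         ≡⟨ rank-aligned σ τ (suc-injective eq) (λ k k< → cmp (suc k) (s≤s k<)) ⟩
  rank b τ         ≡⟨ cong length (filter-reject (_<? b) y≮b) ⟨
  rank b (y ∷ τ)   ∎
  where open ≡-Reasoning
... | yes x<a | no y≮b  = ⊥-elim (y≮b (proj₁ (cmp 0 (s≤s z≤n)) x<a))
... | no x≮a  | yes y<b = ⊥-elim (x≮a (proj₂ (cmp 0 (s≤s z≤n)) y<b))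

nth∈ : ∀ xs i → i < length xs → nth xs i ∈ xs
nth∈ (x ∷ xs) zero    _        = here refl
nth∈ (x ∷ xs) (suc i) (s≤s i<) = there (nth∈ xs i i<)

nth-ext : ∀ σ τ → length σ ≡ length τ → (∀ i → i < length σ → nth σ i ≡ nth τ i) → σ ≡ τ
nth-ext []      []      _  _  = refl
nth-ext (x ∷ σ) (y ∷ τ) eq same =
  cong₂ _∷_ (same 0 (s≤s z≤n)) (nth-ext σ τ (suc-injective eq) (λ i i< → same (suc i) (s≤s i<)))

iso-perm-equal : ∀ {σ τ} → IsPerm σ → IsPerm τ → OrderIso σ τ → σ ≡ τ
iso-perm-equal {σ} {τ} σ-perm τ-perm (len , iso) = nth-ext σ τ len λ i i< → begin
  nth σ i                     ≡⟨ rank-perm σ-perm (nth∈ σ i i<) ⟨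
  suc (rank (nth σ i) σ)      ≡⟨ cong suc (rank-aligned σ τ len λ k k< →
                                   Equivalence.to (iso k i k< i<) , Equivalence.from (iso k i k< i<)) ⟩
  suc (rank (nth τ i) τ)      ≡⟨ rank-perm τ-perm (nth∈ τ i (subst (i <_) len i<)) ⟩
  nth τ i                     ∎
  where open ≡-Reasoning

data Deletion : List ℕ → List ℕ → Set where
  del-here  : ∀ {x xs} → Deletion (x ∷ xs) xs
  del-there : ∀ {x xs ys} → Deletion xs ys → Deletion (x ∷ xs) (x ∷ ys)

deletion-++ : ∀ xs {zs ys} → Deletion (xs ++ zs) ys →
  (Σ (List ℕ) λ xs′ → Deletion xs xs′ × ys ≡ xs′ ++ zs) ⊎ (Σ (List ℕ) λ zs′ → Deletion zs zs′ × ys ≡ xs ++ zs′)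
deletion-++ []       d            = inj₂ (_ , d , refl)
deletion-++ (x ∷ xs) del-here     = inj₁ (xs , del-here , refl)
deletion-++ (x ∷ xs) (del-there d) with deletion-++ xs d
... | inj₁ (xs′ , d′ , refl) = inj₁ (x ∷ xs′ , del-there d′ , refl)
... | inj₂ (zs′ , d′ , refl) = inj₂ (zs′ , d′ , refl)

proper-sublist-deletion : ∀ {τ xs : List ℕ} → τ ⊆ xs → length τ < length xs →
                          Σ (List ℕ) λ ys → Deletion xs ys × τ ⊆ ys
proper-sublist-deletion (_ ∷ʳ τ⊆)  _        = _ , del-here , τ⊆
proper-sublist-deletion (refl ∷ τ⊆) (s≤s l<)
  with ys , d , τ⊆′ ← proper-sublist-deletion τ⊆ l< = _ ∷ ys , del-there d , refl ∷ τ⊆′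

α-head : ℕ → List ℕ
α-head j = (2 * j + 4) ∷ 3 ∷ ω j

α-tail : List ℕ
α-tail = 1 ∷ 5 ∷ 2 ∷ []

three<2j+4 : ∀ j → 3 < 2 * j + 4
three<2j+4 j = m≤n+m 4 (2 * j)

pair : ℕ → ℕ
pair m = 2 * (m + 2)

pair≡ : ∀ m → 2 * m + 4 ≡ pair m
pair≡ = by-ring
  where
  by-ring : ∀ m → 2 * m + 4 ≡ 2 * (m + 2)
  by-ring = solve-∀

pair-suc : ∀ m → pair (suc m) ≡ pair m + 2
pair-suc = by-ring
  where
  by-ring : ∀ m → 2 * (suc m + 2) ≡ 2 * (m + 2) + 2
  by-ring = solve-∀

three<pair : ∀ m → 3 < pair m
three<pair m = subst (3 <_) (pair≡ m) (three<2j+4 m)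

next<pair+3 : ∀ m → pair (suc m) < pair m + 3
next<pair+3 m = subst (_< pair m + 3) (sym (pair-suc m)) (+-monoʳ-< (pair m) (n<1+n 2))

pair+3<next+2 : ∀ m → pair m + 3 < pair (suc m) + 2
pair+3<next+2 m = subst (pair m + 3 <_) (sym (trans (cong (_+ 2) (pair-suc m)) (+-assoc (pair m) 2 2)))
                    (+-monoʳ-< (pair m) (n<1+n 3))

pair+2≤next : ∀ m → pair m + 2 ≤ pair (suc m)
pair+2≤next m = ≤-reflexive (sym (pair-suc m))

n<n+3 : ∀ n → n < n + 3
n<n+3 n = subst (_< n + 3) (+-identityʳ n) (+-monoʳ-< n {0} {3} (s≤s z≤n))

ω-large : ∀ m {z} → z ∈ ω m → 3 < z
ω-large (suc m) (here refl)         = three<pair m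
ω-large (suc m) (there (here refl)) = <-trans (three<pair m) (n<n+3 (pair m))
ω-large (suc m) (there (there z∈))  = ω-large m z∈

α-head-large : ∀ j {z} → z ∈ α-head j → 3 ≤ z
α-head-large j (here refl)         = <⇒≤ (three<2j+4 j)
α-head-large j (there (here refl)) = ≤-refl
α-head-large j (there (there z∈))  = <⇒≤ (ω-large j z∈)

-- α j is a permutation of 1 … 2j+5: α (j+1) arises from α j by adding the
-- two new largest values 2j+6 and 2j+7.
ω-length : ∀ m → length (ω m) ≡ 2 * m
ω-length zero    = refl
ω-length (suc m) = trans (cong (λ l → suc (suc l)) (ω-length m)) (sym (double-suc m))
  where
  double-suc : ∀ m → 2 * suc m ≡ suc (suc (2 * m))
  double-suc = solve-∀

α-length : ∀ j → length (α j) ≡ 2 * j + 5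
α-length j = trans (cong (λ l → suc (suc l)) (trans (length-++ (ω j)) (cong (_+ 3) (ω-length j)))) (e j)
  where
  e : ∀ j → suc (suc (2 * j + 3)) ≡ 2 * j + 5
  e = solve-∀

α-↭ : ∀ j → α j ↭ interval 1 (2 * j + 5)
α-↭ zero = begin
  4 ∷ 3 ∷ 1 ∷ 5 ∷ 2 ∷ []  ↭⟨ shift 1 (4 ∷ 3 ∷ []) (5 ∷ 2 ∷ []) ⟩
  1 ∷ 4 ∷ 3 ∷ 5 ∷ 2 ∷ []  ↭⟨ prep 1 (shift 2 (4 ∷ 3 ∷ 5 ∷ []) []) ⟩
  1 ∷ 2 ∷ 4 ∷ 3 ∷ 5 ∷ []  ↭⟨ prep 1 (prep 2 (swap 4 3 ↭-refl)) ⟩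
  1 ∷ 2 ∷ 3 ∷ 4 ∷ 5 ∷ []  ∎
  where open PermutationReasoning
α-↭ (suc j) = begin
  a ∷ 3 ∷ c ∷ b ∷ W                      ↭⟨ swap a 3 ↭-refl ⟩
  3 ∷ a ∷ c ∷ b ∷ W                      ↭⟨ prep 3 (swap a c ↭-refl) ⟩
  3 ∷ c ∷ a ∷ b ∷ W                      ↭⟨ swap 3 c ↭-refl ⟩
  c ∷ 3 ∷ a ∷ b ∷ W                      ↭⟨ prep c (prep 3 (++-comm (a ∷ b ∷ []) W)) ⟩
  c ∷ 3 ∷ W ++ a ∷ b ∷ []                ≡⟨ cong (λ x → x ∷ 3 ∷ W ++ a ∷ b ∷ []) (pair≡ j) ⟨
  α j ++ a ∷ b ∷ []                      ↭⟨ ++⁺ʳ (a ∷ b ∷ []) (α-↭ j) ⟩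
  interval 1 (2 * j + 5) ++ a ∷ b ∷ []   ≡⟨ cong (interval 1 (2 * j + 5) ++_) new-values ⟩
  interval 1 (2 * j + 5) ++ interval (1 + (2 * j + 5)) 2 ≡⟨ interval-++ 1 (2 * j + 5) 2 ⟨
  interval 1 (2 * j + 5 + 2)             ≡⟨ cong (interval 1) (e₃ j) ⟩
  interval 1 (2 * suc j + 5)             ∎
  where
  open PermutationReasoning
  a = 2 * suc j + 4
  b = pair j + 3
  c = pair j
  W = ω j ++ α-tail
  e₁ : ∀ j → 2 * suc j + 4 ≡ 1 + (2 * j + 5)
  e₁ = solve-∀
  e₂ : ∀ j → 2 * (j + 2) + 3 ≡ suc (1 + (2 * j + 5))
  e₂ = solve-∀
  e₃ : ∀ j → 2 * j + 5 + 2 ≡ 2 * suc j + 5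
  e₃ = solve-∀
  new-values : a ∷ b ∷ [] ≡ interval (1 + (2 * j + 5)) 2
  new-values = cong₂ (λ u v → u ∷ v ∷ []) (e₁ j) (e₂ j)

α-perm : ∀ j → IsPerm (α j)
α-perm j = subst (α j ↭_) (trans (cong (interval 1) (sym (α-length j))) (sym (identity-interval _))) (α-↭ j)

Obstruction : List ℕ → List ℕ → Set
Obstruction P Q = Σ ℕ λ z → Σ ℕ λ y → z ∈ P × 3 < z × y ∈ Q ++ α-tail × z < y

ω-obstruction : ∀ m P Q → P ++ Q ≡ ω m → Obstruction ((2 * m + 4) ∷ P) Q
ω-obstruction zero P Q eq with refl ← ++-conicalˡ P Q eq | refl ← ++-conicalʳ P Q eq =
  4 , 5 , here refl , ≤-refl , there (here refl) , ≤-refl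
ω-obstruction (suc m) [] Q refl =
  _ , _ , here refl , three<2j+4 (suc m) , there (here refl) , gap m
  where
  gap : ∀ m → 2 * suc m + 4 < pair m + 3
  gap m = subst₂ _<_ (sym (e₁ m)) (sym (e₂ m)) (+-monoʳ-< (2 * m) {6} {7} ≤-refl)
    where
    e₁ : ∀ m → 2 * suc m + 4 ≡ 2 * m + 6
    e₁ = solve-∀
    e₂ : ∀ m → 2 * (m + 2) + 3 ≡ 2 * m + 7
    e₂ = solve-∀
ω-obstruction (suc m) (_ ∷ []) Q eq with refl , refl ← ∷-injective eq =
  _ , _ , there (here refl) , three<pair m , here refl , n<n+3 (pair m)
ω-obstruction (suc m) (_ ∷ _ ∷ P) Q eq
  with refl , eq′ ← ∷-injective eq
  with refl , eq″ ← ∷-injective eq′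
  with z , y , z∈ , rest ← ω-obstruction m P Q eq″
  = z , y , relocate z∈ , rest
  where
  relocate : ∀ {z} → z ∈ (2 * m + 4) ∷ P → z ∈ (2 * suc m + 4) ∷ pair m ∷ pair m + 3 ∷ P
  relocate (here refl) = there (here (pair≡ m))
  relocate (there z∈)  = there (there (there z∈))

-- The head 2j+4 3 ω j: a read prefix containing 3 contains 2j+4 as well.
α-head-obstruction : ∀ j P Q → P ++ Q ≡ α-head j → 3 ∈ P → Obstruction P Q
α-head-obstruction j (_ ∷ []) Q eq (here 3≡) with refl , _ ← ∷-injective eq =
  ⊥-elim (<-irrefl 3≡ (three<2j+4 j))
α-head-obstruction j (_ ∷ _ ∷ P) Q eq _
  with refl , eq′ ← ∷-injective eq
  with refl , eq″ ← ∷-injective eq′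
  with z , y , z∈ , rest ← ω-obstruction j P Q eq″
  = z , y , relocate z∈ , rest
  where
  relocate : ∀ {z} → z ∈ (2 * j + 4) ∷ P → z ∈ (2 * j + 4) ∷ 3 ∷ P
  relocate (here refl) = here refl
  relocate (there z∈)  = there (there z∈)

-- After 3 has been passed to D2, the machine is stuck: some z ≥ 3 lies in I
-- and some y > z has not reached I.  Then z cannot be output before 2, y can
-- never be pushed onto I above z, and 2 cannot be pushed onto I while y
-- waits in D1 or D2 (all entries there at that time are below 2).

TwoPending : List ℕ → List ℕ → List ℕ → Set
TwoPending inp u v = (∃ λ p → inp ≡ p ++ [ 2 ]) ⊎ (inp ≡ [] × 2 ∈ u) ⊎ (inp ≡ [] × All (_< 2) u × 2 ∈ v)

Blocked : State → Set
Blocked s = WellStacked s × Σ ℕ λ z → Σ ℕ λ y →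
  z ∈ I s × y ∈ input s ++ D1 s ++ D2 s × 3 ≤ z × z < y × TwoPending (input s) (D1 s) (D2 s)

two-remains : ∀ {inp u v} i → TwoPending inp u v → 2 ∈ inp ++ u ++ v ++ i
two-remains i (inj₁ (p , refl))           = ∈-++⁺ˡ (∈-++⁺ʳ p (here refl))
two-remains {inp} i (inj₂ (inj₁ (_ , 2∈)))      = ∈-++⁺ʳ inp (∈-++⁺ˡ 2∈)
two-remains {inp} {u} i (inj₂ (inj₂ (_ , _ , 2∈))) = ∈-++⁺ʳ inp (∈-++⁺ʳ u (∈-++⁺ˡ 2∈))

not-below-two : ∀ {z y} → 3 ≤ z → z < y → ¬ y < 2
not-below-two 3≤z z<y y<2 = <-asym (<-trans 3≤z z<y) y<2

two-pending-pass : ∀ {x inp u v} → Decreasing (x ∷ u) → TwoPending inp (x ∷ u) v → TwoPending inp u (x ∷ v)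
two-pending-pass _        (inj₁ p)                             = inj₁ p
two-pending-pass (x> ∷ _) (inj₂ (inj₁ (e , here refl)))       = inj₂ (inj₂ (e , x> , here refl))
two-pending-pass _        (inj₂ (inj₁ (e , there 2∈)))        = inj₂ (inj₁ (e , 2∈))
two-pending-pass _        (inj₂ (inj₂ (e , _ ∷ u< , 2∈)))     = inj₂ (inj₂ (e , u< , there 2∈))

two-pending-sink : ∀ {x inp u v z y} → Decreasing (x ∷ v) → 3 ≤ z → z < y → y ∈ inp ++ u ++ v →
                   TwoPending inp u (x ∷ v) → TwoPending inp u v
two-pending-sink _ _ _ _ (inj₁ p)                             = inj₁ p
two-pending-sink _ _ _ _ (inj₂ (inj₁ p))                      = inj₂ (inj₁ p)
two-pending-sink _ _ _ _ (inj₂ (inj₂ (e , u< , there 2∈)))    = inj₂ (inj₂ (e , u< , 2∈))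
two-pending-sink {u = u} (v< ∷ _) 3≤z z<y y∈ (inj₂ (inj₂ (refl , u< , here refl))) with ∈-++⁻ u y∈
... | inj₁ y∈u = ⊥-elim (not-below-two 3≤z z<y (All.lookup u< y∈u))
... | inj₂ y∈v = ⊥-elim (not-below-two 3≤z z<y (All.lookup v< y∈v))

blocked-step : ∀ {s t} → s ↝ t → Blocked s → Blocked t
blocked-step step@(read {x} {inp} {u} {v} _) (ws , z , y , z∈ , y∈ , 3≤z , z<y , two) =
  wellStacked-step step ws , z , y , z∈ , ∈-resp-↭ (↭-sym (shift x inp (u ++ v))) y∈ , 3≤z , z<y , read-two two
  where
  read-two : TwoPending (x ∷ inp) u v → TwoPending inp (x ∷ u) v
  read-two (inj₁ ([] , eq)) with refl , refl ← ∷-injective eq = inj₂ (inj₁ (refl , here refl))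
  read-two (inj₁ (_ ∷ p , eq)) with refl , eq′ ← ∷-injective eq = inj₁ (p , eq′)
  read-two (inj₂ (inj₁ (() , _)))
  read-two (inj₂ (inj₂ (() , _)))
blocked-step step@(pass {x} {inp} {u} {v} _) (ws@(u↓ , _) , z , y , z∈ , y∈ , 3≤z , z<y , two) =
  wellStacked-step step ws , z , y , z∈ , ∈-resp-↭ (++⁺ˡ inp (↭-sym (shift x u v))) y∈ , 3≤z , z<y ,
  two-pending-pass u↓ two
blocked-step step@(sink {x} {inp} {u} {v} p) (ws@(_ , v↓ , i↑) , z , y , z∈ , y∈ , 3≤z , z<y , two)
  with ∈-resp-↭ (↭-trans (++⁺ˡ inp (shift x u v)) (shift x inp (u ++ v))) y∈
... | here refl = ⊥-elim (<-asym z<y (above-pushable i↑ z∈ p))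
... | there y∈′ = wellStacked-step step ws , z , y , there z∈ , y∈′ , 3≤z , z<y , two-pending-sink v↓ 3≤z z<y y∈′ two
blocked-step (emit {x} {i = i} (_ , x-min)) (_ , _ , _ , here refl , _ , 3≤z , _ , two) =
  ⊥-elim (<-irrefl refl (<-≤-trans (s≤s (x-min 2 (two-remains (x ∷ i) two))) 3≤z))
blocked-step step@(emit _) (ws , z , y , there z∈ , rest) = wellStacked-step step ws , z , y , z∈ , rest

blocked-never-completes : ∀ {s o} → s ↝* final o → ¬ Blocked s
blocked-never-completes ε (_ , _ , _ , _ , _ , _ , _ , two) with two-remains [] two
... | ()
blocked-never-completes (step ◅ run) b = blocked-never-completes run (blocked-step step b)

record BeforeThree (j : ℕ) (s : State) : Set where
  constructor before-three
  field
    readPart unread : List ℕ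
    split       : readPart ++ unread ≡ α-head j
    input≡      : input s ≡ unread ++ α-tail
    stacks↭     : D1 s ++ D2 s ++ I s ↭ readPart
    three-in-D1 : 3 ∉ D2 s ++ I s
    ordered     : WellStacked s

-- Passing 3 to D2 blocks the machine: the larger entry z of the obstruction
-- cannot be in D1 below 3 nor in D2 (both hold only values below 3), so it is in I.
three-passed : ∀ j {inp u v i o} → st inp (3 ∷ u) v i o ↝ st inp u (3 ∷ v) i o →
               BeforeThree j (st inp (3 ∷ u) v i o) → Blocked (st inp u (3 ∷ v) i o)
three-passed j {u = u} {v} {i} step@(pass p) (before-three P Q split inp≡ stacks _ ws@(u< ∷ _ , v↓ , _))
  with z , y , z∈ , 3<z , y∈ , z<y ← α-head-obstruction j P Q split (∈-resp-↭ stacks (here refl)) =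
  wellStacked-step step ws , z , y , in-I (∈-resp-↭ (↭-sym stacks) z∈) ,
  subst (λ inp → y ∈ inp ++ u ++ 3 ∷ v) (sym inp≡) (∈-++⁺ˡ y∈) , <⇒≤ 3<z , z<y ,
  inj₁ (Q ++ 1 ∷ 5 ∷ [] , trans inp≡ (sym (++-assoc Q (1 ∷ 5 ∷ []) [ 2 ])))
  where
  in-I : z ∈ (3 ∷ u) ++ v ++ i → z ∈ i
  in-I (here refl) = ⊥-elim (<-irrefl refl 3<z)
  in-I (there z∈′) with ∈-++⁻ u z∈′
  ... | inj₁ z∈u = ⊥-elim (<-asym 3<z (All.lookup u< z∈u))
  ... | inj₂ z∈vi with ∈-++⁻ v z∈vi
  ...   | inj₁ z∈v = ⊥-elim (<-asym 3<z (below-pushable v↓ z∈v p))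
  ...   | inj₂ z∈i = z∈i

-- Until 3 is passed nothing can be output (1 is still unread) and 1 cannot be
-- read (D1 is empty, so 3 would be in D2 or I, or its top is at least 3); so
-- each step either keeps the invariant or passes 3, which blocks the machine.
before-three-step : ∀ j {s t} → s ↝ t → BeforeThree j s → BeforeThree j t ⊎ Blocked t
before-three-step j (read {u = u} {v} {i} p) (before-three P [] split refl stacks 3∉ _) =
  ⊥-elim (one-blocked u p stacks)
  where
  3∈P : 3 ∈ P
  3∈P = subst (3 ∈_) (trans (sym split) (++-identityʳ P)) (there (here refl))
  one-blocked : ∀ u → CanPushD 1 u → u ++ v ++ i ↭ P → ⊥
  one-blocked []      _   stacks = 3∉ (∈-resp-↭ (↭-sym stacks) 3∈P)
  one-blocked (w ∷ _) w<1 stacks =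
    <⇒≱ w<1 (≤-trans (s≤s z≤n) (α-head-large j (subst (w ∈_) split (∈-++⁺ˡ (∈-resp-↭ stacks (here refl))))))
before-three-step j step@(read {x} _) (before-three P (_ ∷ Q) split refl stacks 3∉ ws) =
  inj₁ (before-three (P ++ [ x ]) Q (trans (++-assoc P [ x ] Q) split) refl
         (↭-trans (prep x stacks) (∷↭∷ʳ x P)) 3∉ (wellStacked-step step ws))
before-three-step j step@(pass {x} {u = u} {v} {i} _) bt@(before-three P Q split inp≡ stacks 3∉ ws) with x ≟ 3
... | yes refl = inj₂ (three-passed j step bt)
... | no x≢3 = inj₁ (before-three P Q split inp≡ (↭-trans (↭-sym (pass-↭ x [] u v i)) stacks) 3∉′ (wellStacked-step step ws))
  where
  3∉′ : 3 ∉ (x ∷ v) ++ i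
  3∉′ (here 3≡x) = x≢3 (sym 3≡x)
  3∉′ (there 3∈) = 3∉ 3∈
before-three-step j step@(sink {x} {u = u} {v} {i} _) (before-three P Q split inp≡ stacks 3∉ ws) =
  inj₁ (before-three P Q split inp≡ (↭-trans (↭-sym (sink-↭ x [] u v i)) stacks)
         (λ 3∈ → 3∉ (∈-resp-↭ (↭-sym (sink-↭ x [] [] v i)) 3∈)) (wellStacked-step step ws))
before-three-step j (emit {x} {u = u} {v} (_ , x-min)) (before-three P Q split refl stacks _ _) =
  ⊥-elim (<⇒≱ (≤-trans (s≤s (s≤s z≤n)) 3≤x) (x-min 1 (∈-++⁺ˡ (∈-++⁺ʳ Q (here refl)))))
  where
  3≤x : 3 ≤ x
  3≤x = α-head-large j (subst (x ∈_) split (∈-++⁺ˡ (∈-resp-↭ stacks (∈-++⁺ʳ u (∈-++⁺ʳ v (here refl))))))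

before-three-never-completes : ∀ j {s o} → s ↝* final o → ¬ BeforeThree j s
before-three-never-completes j ε (before-three _ Q _ inp≡ _ _ _) with () ← ++-conicalʳ Q α-tail (sym inp≡)
before-three-never-completes j (step ◅ run) bt with before-three-step j step bt
... | inj₁ bt′ = before-three-never-completes j run bt′
... | inj₂ b   = blocked-never-completes run b

α-not-completes : ∀ j → ¬ Completes (start (α j))
α-not-completes j (_ , run) =
  before-three-never-completes j run (before-three [] (α-head j) refl refl ↭-refl (λ ()) ([] , [] , []))

drain : ∀ {i o} → Increasing i → Completes (st [] [] [] i o)
drain {[]}    _              = _ , ε
drain {x ∷ i} (x< ∷ rest) = after (emit (here refl , x-min) ◅ ε) (drain rest)
  where
  x-min : ∀ y → y ∈ x ∷ i → x ≤ y
  x-min y (here refl) = ≤-refl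
  x-min y (there y∈)  = <⇒≤ (All.lookup x< y∈)

finish-last : ∀ {x i o} → Increasing i → x ∉ i → Completes (st [ x ] [] [] i o)
finish-last {x} {[]} _ _ = after (read tt ◅ pass tt ◅ sink tt ◅ ε) (drain ([] ∷ []))
finish-last {x} {y ∷ i} i↑@(y< ∷ rest) x∉ with <-cmp x y
... | tri< x<y _ _ = after (read tt ◅ pass tt ◅ sink x<y ◅ ε) (drain (push-increasing x<y i↑))
... | tri≈ _ refl _ = ⊥-elim (x∉ (here refl))
... | tri> _ _ y<x = after (emit (∈-++⁺ʳ [ x ] (here refl) , y-min) ◅ ε) (finish-last rest (x∉ ∘ there))
  where
  y-min : ∀ z → z ∈ x ∷ y ∷ i → y ≤ z
  y-min z (here refl)         = <⇒≤ y<x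
  y-min z (there (here refl)) = ≤-refl
  y-min z (there (there z∈))  = <⇒≤ (All.lookup y< z∈)

finish-one-last : ∀ {x i o} → Increasing i → All (1 <_) i → 1 < x → x ∉ i →
                  Completes (st [ x ] [ 1 ] [] i o)
finish-one-last {x} {i} i↑ i>1 x>1 x∉ =
  after (pass tt ◅ sink (pushable i>1) ◅ emit (∈-++⁺ʳ [ x ] (here refl) , one-min) ◅ ε) (finish-last i↑ x∉)
  where
  pushable : ∀ {i} → All (1 <_) i → CanPushI 1 i
  pushable []        = tt
  pushable (1<y ∷ _) = 1<y
  one-min : ∀ z → z ∈ x ∷ 1 ∷ i → 1 ≤ z
  one-min z (here refl)         = <⇒≤ x>1
  one-min z (there (here refl)) = ≤-refl
  one-min z (there (there z∈))  = <⇒≤ (All.lookup i>1 z∈)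

lit< : ∀ {m n} {m<n : True (m <? n)} → m < n
lit< {m<n = m<n} = toWitness m<n

below-increasing : ∀ {x y i} → x < y → Increasing (y ∷ i) → All (x <_) (y ∷ i)
below-increasing x<y (y< ∷ _) = x<y ∷ All.map (<-trans x<y) y<

∉-increasing : ∀ {x y i} → x < y → Increasing (y ∷ i) → x ∉ y ∷ i
∉-increasing x<y i↑ x∈ = <-irrefl refl (All.lookup (below-increasing x<y i↑) x∈)

Floor : ℕ → List ℕ → Set
Floor b i = Increasing i × All (b ≤_) i

sink-onto : ∀ {x b i} → x < b → Floor b i → CanPushI x i
sink-onto {i = []}    _   _             = tt
sink-onto {i = _ ∷ _} x<b (_ , b≤y ∷ _) = <-≤-trans x<b b≤y

floor-push : ∀ {b c x i} → b ≤ x → x < c → Floor c i → Floor b (x ∷ i)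
floor-push b≤x x<c i≥@(i↑ , c≤i) =
  push-increasing (sink-onto x<c i≥) i↑ , b≤x ∷ All.map (≤-trans (≤-trans b≤x (<⇒≤ x<c))) c≤i

-- In the endings below values up to 5 go onto a part of I that is Floor 6.

finish-152 : ∀ {c i o} → 2 < c → c < 5 → Floor 6 i → Completes (st α-tail [] [ c ] i o)
finish-152 {c} {i} 2<c c<5 i6@(i↑ , _) =
  after (read tt ◅ read lit< ◅ pass c<5 ◅ sink (sink-onto lit< i6) ◅ sink c<5 ◅ ε)
        (finish-one-last I↑ (below-increasing (<-trans lit< 2<c) I↑) lit< (∉-increasing 2<c I↑))
  where
  I↑ : Increasing (c ∷ 5 ∷ i)
  I↑ = push-increasing c<5 (push-increasing (sink-onto lit< i6) i↑)

I345↑ : ∀ {i} → Floor 6 i → Increasing (3 ∷ 4 ∷ 5 ∷ i)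
I345↑ i6@(i↑ , _) = push-increasing lit< (push-increasing lit< (push-increasing (sink-onto lit< i6) i↑))

I34↑ : ∀ {i} → Floor 6 i → Increasing (3 ∷ 4 ∷ i)
I34↑ i6@(i↑ , _) = push-increasing lit< (push-increasing (sink-onto lit< i6) i↑)

finish-152-43 : ∀ {i o} → Floor 6 i → Completes (st α-tail [] (4 ∷ 3 ∷ []) i o)
finish-152-43 i6 =
  after (read tt ◅ read lit< ◅ pass lit< ◅ sink (sink-onto lit< i6) ◅ sink lit< ◅ sink lit< ◅ ε)
        (finish-one-last (I345↑ i6) (below-increasing lit< (I345↑ i6)) lit< (∉-increasing lit< (I345↑ i6)))

finish-52 : ∀ {i o} → Floor 6 i → Completes (st (5 ∷ 2 ∷ []) [ 3 ] [ 4 ] i o)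
finish-52 i6 =
  after (read lit< ◅ pass lit< ◅ sink (sink-onto lit< i6) ◅ sink lit< ◅ pass tt ◅ sink lit< ◅ ε)
        (finish-last (I345↑ i6) (∉-increasing lit< (I345↑ i6)))

finish-1x : ∀ {x i o} → 1 < x → x ∉ 3 ∷ 4 ∷ i → Floor 6 i → Completes (st (1 ∷ x ∷ []) [ 3 ] [ 4 ] i o)
finish-1x 1<x x∉ i6 =
  after (sink (sink-onto lit< i6) ◅ pass tt ◅ sink lit< ◅ read tt ◅ ε)
        (finish-one-last (I34↑ i6) (below-increasing lit< (I34↑ i6)) 1<x x∉)

finish-12 : ∀ {i o} → Floor 6 i → Completes (st (1 ∷ 2 ∷ []) [ 3 ] [ 4 ] i o)
finish-12 i6 = finish-1x lit< (∉-increasing lit< (I34↑ i6)) i6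

finish-15 : ∀ {i o} → Floor 6 i → Completes (st (1 ∷ 5 ∷ []) [ 3 ] [ 4 ] i o)
finish-15 i6@(_ , i≥6) = finish-1x lit< 5∉ i6
  where
  5∉ : 5 ∉ 3 ∷ 4 ∷ _
  5∉ (there (there 5∈)) = <-irrefl refl (<-≤-trans lit< (All.lookup i≥6 5∈))

-- Processing the pairs of ω: with D2 holding pair (m+1), the pair
-- (pair m , pair m + 3) is read, pair m + 3 and pair (m+1) sink into I, and
-- pair m replaces pair (m+1) on D2.  D1 and the rest of D2 only hold values
-- at most 3.

Low : List ℕ → Set
Low d = ∀ x → 3 < x → CanPushD x d

low-[] : Low []
low-[] _ _ = tt

low-3 : Low [ 3 ]
low-3 _ 3<x = 3<x

pair-step : ∀ m {rest d₁ d₂ i o} → Low d₁ → Low d₂ → Floor (pair (suc m) + 2) i →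
  st (pair m ∷ pair m + 3 ∷ rest) d₁ (pair (suc m) ∷ d₂) i o ↝*
  st rest d₁ (pair m ∷ d₂) (pair (suc m) ∷ pair m + 3 ∷ i) o
  × Floor (pair m + 2) (pair (suc m) ∷ pair m + 3 ∷ i)
pair-step m low₁ low₂ i≥ =
  read (low₁ _ (three<pair m)) ◅ read (n<n+3 (pair m)) ◅ pass (next<pair+3 m) ◅
  sink (sink-onto (pair+3<next+2 m) i≥) ◅ sink (next<pair+3 m) ◅ pass (low₂ _ (three<pair m)) ◅ ε ,
  floor-push (pair+2≤next m) (next<pair+3 m) (floor-push ≤-refl (pair+3<next+2 m) i≥)

ω-pass : ∀ m {rest d₁ d₂ i o} → Low d₁ → Low d₂ → Floor (pair m + 2) i →
  Σ (List ℕ) λ i′ → st (ω m ++ rest) d₁ (pair m ∷ d₂) i o ↝* st rest d₁ (4 ∷ d₂) i′ o × Floor 6 i′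
ω-pass zero    _    _    i≥ = _ , ε , i≥
ω-pass (suc m) low₁ low₂ i≥
  with run , i≥′ ← pair-step m low₁ low₂ i≥
  with i′ , run′ , i6 ← ω-pass m low₁ low₂ i≥′
  = i′ , run ◅◅ run′ , i6

-- ω followed by the tail, with 3 alone in D2: the first pair settles on 3,
-- and the remaining pairs are processed as usual.
ω-over-three : ∀ m {i o} → Floor (pair m + 2) i → Completes (st (ω m ++ α-tail) [] [ 3 ] i o)
ω-over-three zero    i≥ = finish-152 lit< lit< i≥
ω-over-three (suc m) i≥
  with _ , run , i6 ← ω-pass m low-[] low-3 (floor-push (+-monoʳ-≤ (pair m) (n≤1+n 2)) (pair+3<next+2 m) i≥)
  = after (read tt ◅ pass (three<pair m) ◅ read tt ◅ pass (n<n+3 (pair m)) ◅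
           sink (sink-onto (pair+3<next+2 m) i≥) ◅ ε)
          (after run (finish-152-43 i6))

-- If the
-- deleted entry belongs to the first pair, 3 moves to D2 below the remaining
-- entry of that pair; otherwise the first pair is processed as usual.
ω-deletion : ∀ m {ω′ i o} → Deletion (ω m) ω′ → Floor (pair m + 2) i →
             Completes (st (ω′ ++ α-tail) [ 3 ] [ pair m ] i o)
ω-deletion (suc m) del-here i≥ =
  after (read (<-trans (three<pair m) (n<n+3 (pair m))) ◅ pass (next<pair+3 m) ◅
         sink (sink-onto (pair+3<next+2 m) i≥) ◅ sink (next<pair+3 m) ◅ pass tt ◅ ε)
        (ω-over-three m (floor-push (pair+2≤next m) (next<pair+3 m) (floor-push ≤-refl (pair+3<next+2 m) i≥)))
ω-deletion (suc m) (del-there del-here) i≥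
  with _ , run , i6 ← ω-pass m low-[] low-3 (floor-push (pair+2≤next m) (m<m+n _ (s≤s z≤n)) i≥)
  = after (sink (sink-onto (m<m+n _ (s≤s z≤n)) i≥) ◅ pass tt ◅ read tt ◅ pass (three<pair m) ◅ ε)
          (after run (finish-152-43 i6))
ω-deletion (suc m) (del-there (del-there d)) i≥
  with run , i≥′ ← pair-step m low-3 low-[] i≥
  = after run (ω-deletion m d i≥′)

tail-deletion : ∀ {t i o} → Deletion α-tail t → Floor 6 i → Completes (st t [ 3 ] [ 4 ] i o)
tail-deletion del-here                           = finish-52
tail-deletion (del-there del-here)               = finish-12
tail-deletion (del-there (del-there del-here))   = finish-15
tail-deletion (del-there (del-there (del-there ())))

first-on-D2 : ∀ j {W d₁} → Completes (st W d₁ [ pair j ] [] []) → Completes (st W d₁ [ 2 * j + 4 ] [] [])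
first-on-D2 j {W} {d₁} = subst (λ a → Completes (st W d₁ [ a ] [] [])) (sym (pair≡ j))

α-deletion-completes : ∀ j {ys} → Deletion (α j) ys → Completes (start ys)
α-deletion-completes j del-here =
  after (read tt ◅ pass tt ◅ ε) (ω-over-three j ([] , []))
α-deletion-completes j (del-there del-here)
  with _ , run , i6 ← ω-pass j low-[] low-[] ([] , [])
  = after (read tt ◅ pass tt ◅ ε) (first-on-D2 j (after run (finish-152 lit< lit< i6)))
α-deletion-completes j (del-there (del-there d)) =
  after (read tt ◅ pass tt ◅ read tt ◅ ε) (first-on-D2 j (rest (deletion-++ (ω j) d)))
  where
  rest : ∀ {ys} → (Σ (List ℕ) λ ω′ → Deletion (ω j) ω′ × ys ≡ ω′ ++ α-tail)
                ⊎ (Σ (List ℕ) λ t → Deletion α-tail t × ys ≡ ω j ++ t) →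
         Completes (st ys [ 3 ] [ pair j ] [] [])
  rest (inj₁ (_ , d′ , refl)) = ω-deletion j d′ ([] , [])
  rest (inj₂ (_ , d′ , refl)) with _ , run , i6 ← ω-pass j low-3 low-[] ([] , []) =
    after run (tail-deletion d′ i6)

α-proper-patterns : ∀ j σ → IsPerm σ → σ ≼ α j → σ ≢ α j → Sortable2 σ
α-proper-patterns j σ σ-perm (τ , τ⊆ , iso) σ≢ with length τ <? length (α j)
... | yes shorter with ys , d , τ⊆ys ← proper-sublist-deletion τ⊆ shorter =
  completes⇒sortable σ-perm (pattern-closed (τ , τ⊆ys , iso) (α-deletion-completes j d))
... | no not-shorter = ⊥-elim (σ≢ (iso-perm-equal σ-perm (α-perm j) (subst (OrderIso σ) τ≡α iso)))
  where
  τ≡α : τ ≡ α j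
  τ≡α = Pointwise-≡⇒≡ (toPointwise (≤-antisym (length-mono-≤ τ⊆) (≮⇒≥ not-shorter)) τ⊆)

α-in-basis : ∀ j → InBasis (α j)
α-in-basis j = α-perm j , (λ sortable → α-not-completes j (sortable⇒completes (α-perm j) sortable)) ,
               α-proper-patterns j

length≤total : ∀ {xs} (L : List (List ℕ)) → xs ∈ L → length xs ≤ sum (map length L)
length≤total (xs ∷ L) (here refl) = m≤m+n (length xs) _
length≤total (ys ∷ L) (there xs∈) = ≤-trans (length≤total L xs∈) (m≤n+m _ (length ys))

α-longer : ∀ j → j < length (α j)
α-longer j = subst (j <_) (sym (α-length j)) (≤-<-trans (m≤m+n j (j + 0)) (m<m+n (2 * j) (s≤s z≤n)))

-- No finite list contains all α j: α (total length of the list) is too long.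
α-not-listed : ∀ (L : List (List ℕ)) → α (sum (map length L)) ∉ L
α-not-listed L α∈ = <⇒≱ (α-longer (sum (map length L))) (length≤total L α∈)

corollary1 : ((j : ℕ) → InBasis (α j))
    × ((L : List (List ℕ)) → Σ (List ℕ) λ π → InBasis π × π ∉ L)
corollary1 = α-in-basis , λ L → α (sum (map length L)) , α-in-basis _ , α-not-listed L
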